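{- Let $n\geq 2$. There is a bijection $$\varphi: \bigcup_{0\leq k\leq n-2}\mathcal{MP}_{n,k}^{D*}\to \bigcup_{1\leq k\leq \lfloor n/2\rfloor}\mathcal{MP}_{n,2k}^{*U}.$$
   Context: A Motzkin prefix is a lattice path from $(0,0)$ using up steps $U=(1,1)$, down steps $D=(1,-1)$ and flat steps $F=(1,0)$ that never goes below the $x$-axis (i.e. a prefix of a Motzkin path). $\mathcal{MP}_{n,k}$ is the set of Motzkin prefixes from $(0,0)$ to $(n,k)$; $\mathcal{MP}_{n,k}^{*U}$ is the set of $M\in\mathcal{MP}_{n,k}$ whose last non-flat step is $U$; $\mathcal{MP}_{n,k}^{D*}$ is the set of $M\in\mathcal{MP}_{n,k}$ whose first non-up step is $D$. -}

module Defs where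

open import Data.Nat using (ℕ; zero; suc; _+_; _∸_; _≤_; _/_)
open import Data.Bool using (Bool; true; false; _∧_)
open import Data.Maybe using (Maybe; just; nothing)
open import Data.Vec using (Vec; []; _∷_)
open import Data.Product using (Σ; _×_; ∃-syntax)
open import Relation.Binary.PropositionalEquality using (_≡_)

-- Steps: U = (1,1), D = (1,-1), F = (1,0)
data Step : Set where
  U D F : Step

endHeight : {n : ℕ} → ℕ → Vec Step n → Maybe ℕ
endHeight h []            = just h
endHeight h (U ∷ s)       = endHeight (suc h) s
endHeight zero (D ∷ s)    = nothing
endHeight (suc h) (D ∷ s) = endHeight h s
endHeight h (F ∷ s)       = endHeight h s

-- A word of n steps is a Motzkin prefix from (0,0) to (n,k).
IsMP : (n k : ℕ) → Vec Step n → Set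
IsMP n k w = endHeight 0 w ≡ just k

lastNonFlat : {n : ℕ} → Vec Step n → Maybe Step
lastNonFlat []      = nothing
lastNonFlat (x ∷ w) with lastNonFlat w
... | just s  = just s
... | nothing with x
...   | F = nothing
...   | y = just y

firstNonUp : {n : ℕ} → Vec Step n → Maybe Step
firstNonUp []      = nothing
firstNonUp (U ∷ w) = firstNonUp w
firstNonUp (x ∷ w) = just x

MP : ℕ → ℕ → Set
MP n k = Σ (Vec Step n) λ w → IsMP n k w

MP*U : ℕ → ℕ → Set
MP*U n k = Σ (Vec Step n) λ w → IsMP n k w × lastNonFlat w ≡ just U

MPD* : ℕ → ℕ → Set
MPD* n k = Σ (Vec Step n) λ w → IsMP n k w × firstNonUp w ≡ just D

-- ⋃_{0 ≤ k ≤ n-2} MP_{n,k}^{D*}  (disjoint union, tagged by the endpoint height k)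
Domain : ℕ → Set
Domain n = Σ ℕ λ k → k ≤ n ∸ 2 × MPD* n k

Codomain : ℕ → Set
Codomain n = Σ ℕ λ k → (1 ≤ k × k ≤ n / 2) × MP*U n (k + k)

{-# OPTIONS --safe #-}
module Submission where

-- Write a path of the domain as Uʲ⁺¹ D w. Cutting w at the steps where it first reaches a new level
-- below its start gives w = w₀ D w₁ D ⋯ D wᵢ, and i ≤ j because the path stays above the axis.
-- Prefixing every wₜ with t < i by U, and wᵢ by U or F according as wᵢ ends at even or odd height
-- above its start, yields a Motzkin prefix raise w = U w₀ D ⋯ D σ wᵢ ending at odd height, from
-- which lower recovers w by cutting at the returns to the axis. So both sides are parametrised by
-- the pairs (w, c) with c = j − i: the path Uⁱ⁺ᶜ⁺¹ D w on one side, (raise w) U Fᶜ on the other.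

open import Defs
open import Data.Nat using (ℕ; zero; suc; _+_; _*_; _∸_; _≤_; _/_; z≤n; s≤s)
open import Data.Nat.Properties
open import Data.Nat.DivMod using (m*n/n≡m; /-monoˡ-≤)
open import Data.Nat.Tactic.RingSolver using (solve-∀)
open import Data.Bool using (Bool; true; false; not)
open import Data.Bool.Properties using (not-injective)
open import Data.Maybe using (Maybe; just; nothing; _>>=_)
import Data.Maybe.Properties as Maybe
open import Data.List using (List; []; _∷_; _++_; length; replicate)
open import Data.List.Properties using (length-++; length-replicate; ∷-injective; ∷-injectiveʳ)
open import Data.Vec using (Vec; toList; fromList; cast)
open import Data.Vec.Properties
  using (cast-is-id; fromList∘toList; toList∘fromList; toList-cast; toList-injective; length-toList)
open import Data.Product using (Σ; _×_; _,_; ∃-syntax; ∃₂)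
open import Data.Empty using (⊥-elim)
open import Relation.Binary.PropositionalEquality
open import Relation.Binary.Definitions using (DecidableEquality)
open import Relation.Nullary using (yes; no)
open import Axiom.UniquenessOfIdentityProofs using (module Decidable⇒UIP)
open import Function.Bundles using (_⤖_; _↔_; mk↔ₛ′)
open import Function.Properties.Inverse using (↔-trans; ↔-sym; ↔⇒⤖)

height : ℕ → List Step → Maybe ℕ
height h l = endHeight h (fromList l)

height-++ : ∀ h l l′ → height h (l ++ l′) ≡ (height h l >>= λ h′ → height h′ l′)
height-++ h       []      l′ = refl
height-++ h       (U ∷ l) l′ = height-++ (suc h) l l′
height-++ h       (F ∷ l) l′ = height-++ h l l′
height-++ zero    (D ∷ l) l′ = refl
height-++ (suc h) (D ∷ l) l′ = height-++ h l l′

height-Uⁿ++ : ∀ h a l → height h (replicate a U ++ l) ≡ height (h + a) l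
height-Uⁿ++ h zero    l = cong (λ h′ → height h′ l) (sym (+-identityʳ h))
height-Uⁿ++ h (suc a) l = trans (height-Uⁿ++ (suc h) a l) (cong (λ h′ → height h′ l) (sym (+-suc h a)))

height-Fⁿ : ∀ h c → height h (replicate c F) ≡ just h
height-Fⁿ h zero    = refl
height-Fⁿ h (suc c) = height-Fⁿ h c

height-++U∷Fⁿ : ∀ h l c {e} → height h l ≡ just e → height h (l ++ U ∷ replicate c F) ≡ just (suc e)
height-++U∷Fⁿ h l c {e} eq =
  trans (height-++ h l (U ∷ replicate c F)) (trans (cong (_>>= _) eq) (height-Fⁿ (suc e) c))

height-+ : ∀ h c l {k} → height h l ≡ just k → height (h + c) l ≡ just (k + c)
height-+ h       c []      refl = refl
height-+ h       c (U ∷ l) eq   = height-+ (suc h) c l eq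
height-+ h       c (F ∷ l) eq   = height-+ h c l eq
height-+ (suc h) c (D ∷ l) eq   = height-+ h c l eq

height≤ : ∀ h l {k} → height h l ≡ just k → k ≤ h + length l
height≤ h       []      refl = ≤-reflexive (sym (+-identityʳ h))
height≤ h       (U ∷ l) eq   = ≤-trans (height≤ (suc h) l eq) (≤-reflexive (sym (+-suc h (length l))))
height≤ h       (F ∷ l) eq   = ≤-trans (height≤ h l eq) (+-monoʳ-≤ h (n≤1+n (length l)))
height≤ (suc h) (D ∷ l) eq   = ≤-trans (height≤ h l eq) (+-mono-≤ (n≤1+n h) (n≤1+n (length l)))

even : ℕ → Bool
even zero    = true
even (suc n) = not (even n)

even-double : ∀ m → even (m + m) ≡ true
even-double zero    = refl
even-double (suc m) rewrite +-suc m m | even-double m = refl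

mutual
  even⇒double : ∀ e → even e ≡ true → ∃[ m ] e ≡ m + m
  even⇒double zero    _ = 0 , refl
  even⇒double (suc e) p with odd⇒suc-double e (not-injective p)
  ... | m , eq = suc m , eq

  odd⇒suc-double : ∀ e → even e ≡ false → ∃[ m ] suc e ≡ suc m + suc m
  odd⇒suc-double (suc e) p with even⇒double e (not-injective p)
  ... | m , refl = m , cong suc (sym (+-suc m m))

m*2≡m+m : ∀ m → m * 2 ≡ m + m
m*2≡m+m m = trans (*-comm m 2) (cong (m +_) (+-identityʳ m))

double-injective : ∀ m n → m + m ≡ n + n → m ≡ n
double-injective m n eq = *-cancelʳ-≡ m n 2 (trans (m*2≡m+m m) (trans eq (sym (m*2≡m+m n))))

double≤⇒≤half : ∀ K {n} → K + K ≤ n → K ≤ n / 2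
double≤⇒≤half K {n} K+K≤n = begin
  K          ≡⟨ m*n/n≡m K 2 ⟨
  K * 2 / 2  ≤⟨ /-monoˡ-≤ 2 (≤-trans (≤-reflexive (m*2≡m+m K)) K+K≤n) ⟩
  n / 2      ∎
  where open ≤-Reasoning

letter : Bool → Step
letter true  = U
letter false = F

-- The argument is the final height of a segment above its start, nothing if a D closes it.
leader : Maybe ℕ → Bool
leader nothing  = true
leader (just e) = even e

mutual
  -- r is the height of the rest of the path above the start of its current segment.
  raiseAt : ℕ → List Step → List Step
  raiseAt r       []      = []
  raiseAt r       (U ∷ w) = U ∷ raiseAt (suc r) w
  raiseAt r       (F ∷ w) = F ∷ raiseAt r w
  raiseAt (suc r) (D ∷ w) = D ∷ raiseAt r w
  raiseAt zero    (D ∷ w) = D ∷ raise w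

  raise : List Step → List Step
  raise w = letter (leader (height 0 w)) ∷ raiseAt 0 w

mutual
  -- The rest of the path is at height r + 1.
  lowerAt : ℕ → List Step → List Step
  lowerAt r       []      = []
  lowerAt r       (U ∷ v) = U ∷ lowerAt (suc r) v
  lowerAt r       (F ∷ v) = F ∷ lowerAt r v
  lowerAt (suc r) (D ∷ v) = D ∷ lowerAt r v
  lowerAt zero    (D ∷ v) = D ∷ lower v

  lower : List Step → List Step
  lower (U ∷ v) = lowerAt 0 v
  lower (F ∷ v) = v
  lower _       = []

drops : ℕ → List Step → ℕ
drops r       []      = 0
drops r       (U ∷ w) = drops (suc r) w
drops r       (F ∷ w) = drops r w
drops (suc r) (D ∷ w) = drops r w
drops zero    (D ∷ w) = suc (drops 0 w)

raiseAt-stable : ∀ r w {e} → height r w ≡ just e → raiseAt r w ≡ w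
raiseAt-stable r       []      _  = refl
raiseAt-stable r       (U ∷ w) eq = cong (U ∷_) (raiseAt-stable (suc r) w eq)
raiseAt-stable r       (F ∷ w) eq = cong (F ∷_) (raiseAt-stable r w eq)
raiseAt-stable (suc r) (D ∷ w) eq = cong (D ∷_) (raiseAt-stable r w eq)

mutual
  lowerAt-raiseAt : ∀ r w → lowerAt r (raiseAt r w) ≡ w
  lowerAt-raiseAt r       []      = refl
  lowerAt-raiseAt r       (U ∷ w) = cong (U ∷_) (lowerAt-raiseAt (suc r) w)
  lowerAt-raiseAt r       (F ∷ w) = cong (F ∷_) (lowerAt-raiseAt r w)
  lowerAt-raiseAt (suc r) (D ∷ w) = cong (D ∷_) (lowerAt-raiseAt r w)
  lowerAt-raiseAt zero    (D ∷ w) = cong (D ∷_) (lower-raise w)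

  lower-raise : ∀ w → lower (raise w) ≡ w
  lower-raise w with height 0 w in eq
  ... | nothing = lowerAt-raiseAt 0 w
  ... | just e with even e
  ...   | true  = lowerAt-raiseAt 0 w
  ...   | false = raiseAt-stable 0 w eq

leader-lowerAt : ∀ r v {e} → height (suc r) v ≡ just e → even e ≡ false →
                 leader (height r (lowerAt r v)) ≡ true
leader-lowerAt r       []      refl odd = not-injective odd
leader-lowerAt r       (U ∷ v) eq   odd = leader-lowerAt (suc r) v eq odd
leader-lowerAt r       (F ∷ v) eq   odd = leader-lowerAt r v eq odd
leader-lowerAt (suc r) (D ∷ v) eq   odd = leader-lowerAt r v eq odd
leader-lowerAt zero    (D ∷ v) eq   odd = refl

mutual
  raiseAt-lowerAt : ∀ r v {e} → height (suc r) v ≡ just e → even e ≡ false → raiseAt r (lowerAt r v) ≡ v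
  raiseAt-lowerAt r       []      _  _   = refl
  raiseAt-lowerAt r       (U ∷ v) eq odd = cong (U ∷_) (raiseAt-lowerAt (suc r) v eq odd)
  raiseAt-lowerAt r       (F ∷ v) eq odd = cong (F ∷_) (raiseAt-lowerAt r v eq odd)
  raiseAt-lowerAt (suc r) (D ∷ v) eq odd = cong (D ∷_) (raiseAt-lowerAt r v eq odd)
  raiseAt-lowerAt zero    (D ∷ v) eq odd = cong (D ∷_) (raise-lower v eq odd)

  raise-lower : ∀ v {e} → height 0 v ≡ just e → even e ≡ false → raise (lower v) ≡ v
  raise-lower []      refl ()
  raise-lower (U ∷ v) eq   odd
    rewrite leader-lowerAt 0 v eq odd | raiseAt-lowerAt 0 v eq odd = refl
  raise-lower (F ∷ v) eq   odd
    rewrite eq | odd | raiseAt-stable 0 v eq = refl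

height-raiseAt : ∀ r w → ∃[ e ] height r (letter (leader (height r w)) ∷ raiseAt r w) ≡ just e × even e ≡ false
height-raiseAt r [] with even r in eq
... | true  = suc r , refl , cong not eq
... | false = r , refl , eq
height-raiseAt r (U ∷ w) with leader (height (suc r) w) | height-raiseAt (suc r) w
... | true  | ih = ih
... | false | ih = ih
height-raiseAt r (F ∷ w) with leader (height r w) | height-raiseAt r w
... | true  | ih = ih
... | false | ih = ih
height-raiseAt (suc r) (D ∷ w) with leader (height r w) | height-raiseAt r w
... | true  | ih = ih
... | false | ih = ih
height-raiseAt zero (D ∷ w) = height-raiseAt 0 w

height-raise : ∀ w → ∃[ e ] height 0 (raise w) ≡ just e × even e ≡ false
height-raise = height-raiseAt 0

length-raiseAt : ∀ r w → length (raiseAt r w) ≡ length w + drops r w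
length-raiseAt r       []      = refl
length-raiseAt r       (U ∷ w) = cong suc (length-raiseAt (suc r) w)
length-raiseAt r       (F ∷ w) = cong suc (length-raiseAt r w)
length-raiseAt (suc r) (D ∷ w) = cong suc (length-raiseAt r w)
length-raiseAt zero    (D ∷ w) =
  cong suc (trans (cong suc (length-raiseAt 0 w)) (sym (+-suc (length w) (drops 0 w))))

drops≤ : ∀ r μ w {k} → height (r + μ) w ≡ just k → drops r w ≤ μ
drops≤ r       μ       []      _  = z≤n
drops≤ r       μ       (U ∷ w) eq = drops≤ (suc r) μ w eq
drops≤ r       μ       (F ∷ w) eq = drops≤ r μ w eq
drops≤ (suc r) μ       (D ∷ w) eq = drops≤ r μ w eq
drops≤ zero    (suc μ) (D ∷ w) eq = s≤s (drops≤ 0 μ w eq)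

height-drops : ∀ r w → ∃[ k ] height (r + drops r w) w ≡ just k
height-drops r       []      = _ , refl
height-drops r       (U ∷ w) = height-drops (suc r) w
height-drops r       (F ∷ w) = height-drops r w
height-drops (suc r) (D ∷ w) = height-drops r w
height-drops zero    (D ∷ w) = height-drops 0 w

firstNonUp-Uⁿ++D∷ : ∀ a w → firstNonUp (fromList (replicate a U ++ D ∷ w)) ≡ just D
firstNonUp-Uⁿ++D∷ zero    w = refl
firstNonUp-Uⁿ++D∷ (suc a) w = firstNonUp-Uⁿ++D∷ a w

firstNonUp≡D-split : ∀ x → firstNonUp (fromList x) ≡ just D → ∃₂ λ a w → x ≡ replicate a U ++ D ∷ w
firstNonUp≡D-split (U ∷ x) eq with firstNonUp≡D-split x eq
... | a , w , refl = suc a , w , refl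
firstNonUp≡D-split (D ∷ x) eq = 0 , x , refl

Uⁿ++D∷-injective : ∀ a a′ {w w′} → replicate a U ++ D ∷ w ≡ replicate a′ U ++ D ∷ w′ → a ≡ a′ × w ≡ w′
Uⁿ++D∷-injective zero    zero     refl = refl , refl
Uⁿ++D∷-injective (suc a) (suc a′) eq with Uⁿ++D∷-injective a a′ (∷-injectiveʳ eq)
... | refl , refl = refl , refl

lastNonFlat-Fⁿ : ∀ c → lastNonFlat (fromList (replicate c F)) ≡ nothing
lastNonFlat-Fⁿ zero    = refl
lastNonFlat-Fⁿ (suc c) rewrite lastNonFlat-Fⁿ c = refl

lastNonFlat-++U∷Fⁿ : ∀ v c → lastNonFlat (fromList (v ++ U ∷ replicate c F)) ≡ just U
lastNonFlat-++U∷Fⁿ []      c rewrite lastNonFlat-Fⁿ c = refl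
lastNonFlat-++U∷Fⁿ (x ∷ v) c rewrite lastNonFlat-++U∷Fⁿ v c = refl

lastNonFlat≡nothing⇒Fⁿ : ∀ y → lastNonFlat (fromList y) ≡ nothing → y ≡ replicate (length y) F
lastNonFlat≡nothing⇒Fⁿ []      _  = refl
lastNonFlat≡nothing⇒Fⁿ (x ∷ y) eq with lastNonFlat (fromList y) in eq′
lastNonFlat≡nothing⇒Fⁿ (F ∷ y) eq | nothing = cong (F ∷_) (lastNonFlat≡nothing⇒Fⁿ y eq′)

lastNonFlat≡U-split : ∀ y → lastNonFlat (fromList y) ≡ just U → ∃₂ λ v c → y ≡ v ++ U ∷ replicate c F
lastNonFlat≡U-split (x ∷ y) eq with lastNonFlat (fromList y) in eq′
lastNonFlat≡U-split (x ∷ y) refl | just .U with lastNonFlat≡U-split y eq′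
... | v , c , refl = x ∷ v , c , refl
lastNonFlat≡U-split (U ∷ y) eq   | nothing = [] , length y , cong (U ∷_) (lastNonFlat≡nothing⇒Fⁿ y eq′)

Fⁿ≢++U∷ : ∀ c v {t} → replicate c F ≢ v ++ U ∷ t
Fⁿ≢++U∷ zero    []      ()
Fⁿ≢++U∷ zero    (_ ∷ _) ()
Fⁿ≢++U∷ (suc c) (_ ∷ v) eq = Fⁿ≢++U∷ c v (∷-injectiveʳ eq)

++U∷Fⁿ-injective : ∀ v v′ {c c′} → v ++ U ∷ replicate c F ≡ v′ ++ U ∷ replicate c′ F → v ≡ v′ × c ≡ c′
++U∷Fⁿ-injective []      []       {c} {c′} eq =
  refl , trans (sym (length-replicate c)) (trans (cong length (∷-injectiveʳ eq)) (length-replicate c′))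
++U∷Fⁿ-injective []      (_ ∷ v′) {c}       eq = ⊥-elim (Fⁿ≢++U∷ c v′ (∷-injectiveʳ eq))
++U∷Fⁿ-injective (_ ∷ v) []       {c′ = c′} eq = ⊥-elim (Fⁿ≢++U∷ c′ v (sym (∷-injectiveʳ eq)))
++U∷Fⁿ-injective (x ∷ v) (x′ ∷ v′) eq with ∷-injective eq
... | refl , eq′ with ++U∷Fⁿ-injective v v′ eq′
...   | refl , refl = refl , refl

domainWord : List Step → ℕ → List Step
domainWord w c = replicate (suc (drops 0 w + c)) U ++ D ∷ w

codomainWord : List Step → ℕ → List Step
codomainWord w c = raise w ++ U ∷ replicate c F

length-Uⁿ++ : ∀ a l → length (replicate a U ++ l) ≡ a + length l
length-Uⁿ++ a l = trans (length-++ (replicate a U)) (cong (_+ length l) (length-replicate a))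

length-codomainWord : ∀ w c → length (codomainWord w c) ≡ length (domainWord w c)
length-codomainWord w c = begin
  length (raise w ++ U ∷ replicate c F)
    ≡⟨ length-++ (raise w) ⟩
  suc (length (raiseAt 0 w)) + suc (length (replicate c F))
    ≡⟨ cong₂ (λ x y → suc x + suc y) (length-raiseAt 0 w) (length-replicate c) ⟩
  suc (length w + d) + suc c
    ≡⟨ rearrange (length w) d c ⟩
  suc (d + c) + suc (length w)
    ≡⟨ length-Uⁿ++ (suc (d + c)) (D ∷ w) ⟨
  length (domainWord w c) ∎
  where
  open ≡-Reasoning
  d = drops 0 w
  rearrange : ∀ l d c → suc (l + d) + suc c ≡ suc (d + c) + suc l
  rearrange = solve-∀

domainWord-valid : ∀ w c → ∃[ k ] height 0 (domainWord w c) ≡ just k × k ≤ length (domainWord w c) ∸ 2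
domainWord-valid w c with height-drops 0 w
... | k , hk = k + c , trans (height-Uⁿ++ 0 (suc (d + c)) (D ∷ w)) (height-+ d c w hk) , bound
  where
  d = drops 0 w
  bound : k + c ≤ length (domainWord w c) ∸ 2
  bound = begin
    k + c                             ≤⟨ height≤ (d + c) w (height-+ d c w hk) ⟩
    d + c + length w                  ≡⟨ cong (_∸ 1) (+-suc (d + c) (length w)) ⟨
    suc (d + c) + suc (length w) ∸ 2  ≡⟨ cong (_∸ 2) (length-Uⁿ++ (suc (d + c)) (D ∷ w)) ⟨
    length (domainWord w c) ∸ 2       ∎
    where open ≤-Reasoning

codomainWord-valid : ∀ w c → ∃[ K ] (1 ≤ K × K ≤ length (codomainWord w c) / 2) ×
                                    height 0 (codomainWord w c) ≡ just (K + K)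
codomainWord-valid w c with height-raise w
... | e , he , odd with odd⇒suc-double e odd
...   | m , em = suc m , (s≤s z≤n , double≤⇒≤half (suc m) (height≤ 0 (codomainWord w c) hK)) , hK
  where
  hK : height 0 (codomainWord w c) ≡ just (suc m + suc m)
  hK = trans (height-++U∷Fⁿ 0 (raise w) c he) (cong just em)

domainWord-split : ∀ x {k} → height 0 x ≡ just k → firstNonUp (fromList x) ≡ just D →
                   ∃₂ λ w c → x ≡ domainWord w c
domainWord-split x hk fn with firstNonUp≡D-split x fn
... | suc j , w , refl = w , j ∸ d , cong (λ a → replicate (suc a) U ++ D ∷ w) (sym (m+[n∸m]≡n d≤j))
  where
  d = drops 0 w
  d≤j : d ≤ j
  d≤j = drops≤ 0 j w (trans (sym (height-Uⁿ++ 0 (suc j) (D ∷ w))) hk)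

codomainWord-split : ∀ y {K} → height 0 y ≡ just (K + K) → lastNonFlat (fromList y) ≡ just U →
                     ∃₂ λ w c → y ≡ codomainWord w c
codomainWord-split y {K} hK ln with lastNonFlat≡U-split y ln
... | v , c , refl with height 0 v in hv | height-++ 0 v (U ∷ replicate c F)
...   | nothing | hy with () ← trans (sym hy) hK
...   | just e  | _  = lower v , c , cong (_++ U ∷ replicate c F) (sym (raise-lower v hv odd))
  where
  suc-e≡K+K : suc e ≡ K + K
  suc-e≡K+K = Maybe.just-injective (trans (sym (height-++U∷Fⁿ 0 v c hv)) hK)
  odd : even e ≡ false
  odd = not-injective (trans (cong even suc-e≡K+K) (even-double K))

domainWord-injective : ∀ {w w′ c c′} → domainWord w c ≡ domainWord w′ c′ → w ≡ w′ × c ≡ c′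
domainWord-injective {w} {w′} {c} {c′} eq
  with Uⁿ++D∷-injective (suc (drops 0 w + c)) (suc (drops 0 w′ + c′)) eq
... | a≡a′ , refl = refl , +-cancelˡ-≡ (drops 0 w) c c′ (suc-injective a≡a′)

codomainWord-injective : ∀ {w w′ c c′} → codomainWord w c ≡ codomainWord w′ c′ → w ≡ w′ × c ≡ c′
codomainWord-injective {w} {w′} eq with ++U∷Fⁿ-injective (raise w) (raise w′) eq
... | raise-w≡raise-w′ , c≡c′ =
  trans (sym (lower-raise w)) (trans (cong lower raise-w≡raise-w′) (lower-raise w′)) , c≡c′

module _ {A B : Set} (f : ∀ {m} → Vec A m → B) where

  f-cast : ∀ {m n} (eq : m ≡ n) (u : Vec A m) → f (cast eq u) ≡ f u
  f-cast refl u = cong f (cast-is-id refl u)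

  f-fromList∘toList : ∀ {n} (v : Vec A n) → f (fromList (toList v)) ≡ f v
  f-fromList∘toList v = trans (sym (f-cast (length-toList v) _)) (cong f (fromList∘toList v))

toList-cast-fromList : ∀ {A : Set} {n} (l : List A) .(eq : length l ≡ n) → toList (cast eq (fromList l)) ≡ l
toList-cast-fromList l eq = trans (toList-cast eq (fromList l)) (toList∘fromList l)

toList-injective-≡ : ∀ {A : Set} {n} {x x′ : Vec A n} → toList x ≡ toList x′ → x ≡ x′
toList-injective-≡ {x = x} {x′} eq = trans (sym (cast-is-id refl x)) (toList-injective refl x x′ eq)

_≟ₛ_ : DecidableEquality Step
U ≟ₛ U = yes refl
U ≟ₛ D = no λ ()
U ≟ₛ F = no λ ()
D ≟ₛ U = no λ ()
D ≟ₛ D = yes refl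
D ≟ₛ F = no λ ()
F ≟ₛ U = no λ ()
F ≟ₛ D = no λ ()
F ≟ₛ F = yes refl

≡-irrelevant-Maybeℕ : {a b : Maybe ℕ} (p q : a ≡ b) → p ≡ q
≡-irrelevant-Maybeℕ = Decidable⇒UIP.≡-irrelevant (Maybe.≡-dec _≟_)

≡-irrelevant-MaybeStep : {a b : Maybe Step} (p q : a ≡ b) → p ≡ q
≡-irrelevant-MaybeStep = Decidable⇒UIP.≡-irrelevant (Maybe.≡-dec _≟ₛ_)

wordᴰ : ∀ {n} → Domain n → Vec Step n
wordᴰ (_ , _ , x , _) = x

wordᶜ : ∀ {n} → Codomain n → Vec Step n
wordᶜ (_ , _ , y , _) = y

Domain-≡ : ∀ {n} {a b : Domain n} → toList (wordᴰ a) ≡ toList (wordᴰ b) → a ≡ b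
Domain-≡ {a = k , b , x , mp , fn} {k′ , b′ , x′ , mp′ , fn′} eq with toList-injective-≡ eq
... | refl with Maybe.just-injective (trans (sym mp) mp′)
...   | refl with ≤-irrelevant b b′ | ≡-irrelevant-Maybeℕ mp mp′ | ≡-irrelevant-MaybeStep fn fn′
...     | refl | refl | refl = refl

Codomain-≡ : ∀ {n} {a b : Codomain n} → toList (wordᶜ a) ≡ toList (wordᶜ b) → a ≡ b
Codomain-≡ {a = K , (b₁ , b₂) , y , mp , ln} {K′ , (b₁′ , b₂′) , y′ , mp′ , ln′} eq with toList-injective-≡ eq
... | refl with double-injective K K′ (Maybe.just-injective (trans (sym mp) mp′))
...   | refl with ≤-irrelevant b₁ b₁′ | ≤-irrelevant b₂ b₂′
                | ≡-irrelevant-Maybeℕ mp mp′ | ≡-irrelevant-MaybeStep ln ln′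
...     | refl | refl | refl | refl = refl

Param : ℕ → Set
Param n = Σ (List Step) λ w → Σ ℕ λ c → length (domainWord w c) ≡ n

Param-≡ : ∀ {n w w′ c c′} {p : length (domainWord w c) ≡ n} {p′ : length (domainWord w′ c′) ≡ n} →
          w ≡ w′ → c ≡ c′ → _≡_ {A = Param n} (w , c , p) (w′ , c′ , p′)
Param-≡ {p = p} {p′} refl refl = cong (λ q → _ , _ , q) (≡-irrelevant p p′)

module _ {n : ℕ} where

  Domain↔Param : Domain n ↔ Param n
  Domain↔Param = mk↔ₛ′ toParam fromParam toParam∘fromParam fromParam∘toParam
    where
    split : (a : Domain n) → ∃₂ λ w c → toList (wordᴰ a) ≡ domainWord w c
    split (_ , _ , x , mp , fn) =
      domainWord-split (toList x) (trans (f-fromList∘toList (endHeight 0) x) mp)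
                                  (trans (f-fromList∘toList firstNonUp x) fn)

    toParam : Domain n → Param n
    toParam a = let w , c , eq = split a in w , c , trans (cong length (sym eq)) (length-toList (wordᴰ a))

    fromParam : Param n → Domain n
    fromParam (w , c , len) =
      let k , hk , bound = domainWord-valid w c in
      k , subst (λ m → k ≤ m ∸ 2) len bound , cast len (fromList (domainWord w c)) ,
      trans (f-cast (endHeight 0) len _) hk ,
      trans (f-cast firstNonUp len _) (firstNonUp-Uⁿ++D∷ (suc (drops 0 w + c)) w)

    toParam∘fromParam : ∀ p → toParam (fromParam p) ≡ p
    toParam∘fromParam p@(w , c , _) =
      let _ , _ , eq = split (fromParam p)
          w≡w′ , c≡c′ = domainWord-injective (trans (sym (toList-cast-fromList (domainWord w c) _)) eq)
      in Param-≡ (sym w≡w′) (sym c≡c′)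

    fromParam∘toParam : ∀ a → fromParam (toParam a) ≡ a
    fromParam∘toParam a =
      let w , c , eq = split a in Domain-≡ (trans (toList-cast-fromList (domainWord w c) _) (sym eq))

  Codomain↔Param : Codomain n ↔ Param n
  Codomain↔Param = mk↔ₛ′ toParam fromParam toParam∘fromParam fromParam∘toParam
    where
    split : (a : Codomain n) → ∃₂ λ w c → toList (wordᶜ a) ≡ codomainWord w c
    split (K , _ , y , mp , ln) =
      codomainWord-split (toList y) {K} (trans (f-fromList∘toList (endHeight 0) y) mp)
                                        (trans (f-fromList∘toList lastNonFlat y) ln)

    toParam : Codomain n → Param n
    toParam a =
      let w , c , eq = split a in
      w , c , trans (sym (length-codomainWord w c)) (trans (cong length (sym eq)) (length-toList (wordᶜ a)))

    fromParam : Param n → Codomain n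
    fromParam (w , c , len) =
      let K , bounds , hK = codomainWord-valid w c
          len′ = trans (length-codomainWord w c) len
      in
      K , subst (λ m → 1 ≤ K × K ≤ m / 2) len′ bounds , cast len′ (fromList (codomainWord w c)) ,
      trans (f-cast (endHeight 0) len′ _) hK ,
      trans (f-cast lastNonFlat len′ _) (lastNonFlat-++U∷Fⁿ (raise w) c)

    toParam∘fromParam : ∀ p → toParam (fromParam p) ≡ p
    toParam∘fromParam p@(w , c , _) =
      let _ , _ , eq = split (fromParam p)
          w≡w′ , c≡c′ = codomainWord-injective (trans (sym (toList-cast-fromList (codomainWord w c) _)) eq)
      in Param-≡ (sym w≡w′) (sym c≡c′)

    fromParam∘toParam : ∀ a → fromParam (toParam a) ≡ a
    fromParam∘toParam a =
      let w , c , eq = split a in Codomain-≡ (trans (toList-cast-fromList (codomainWord w c) _) (sym eq))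

-- The bijection exists for every n; for n < 2 both sides are empty.
lemma3p1 : (n : ℕ) → 2 ≤ n → Domain n ⤖ Codomain n
lemma3p1 n _ = ↔⇒⤖ (↔-trans Domain↔Param (↔-sym Codomain↔Param))
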